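{- Let $\mathbf A$ be a $\mathsf V$-algebra; then the congruence filters of $\mathbf A$ are exactly the congruence filters of its modal reduct $(A,\land,\lor,\to,\Box,0,1)$.
   Context: A $\mathsf V$-algebra is a Boolean algebra $(A,\wedge,\vee,\to,0,1)$ with a binary operation $\mathbin{\Box\!\!\rightarrow}$ satisfying $x\mathbin{\Box\!\!\rightarrow}x=1$; $((x\mathbin{\Box\!\!\rightarrow}y)\wedge(y\mathbin{\Box\!\!\rightarrow}x))\le((x\mathbin{\Box\!\!\rightarrow}z)\leftrightarrow(y\mathbin{\Box\!\!\rightarrow}z))$; $((x\vee y)\mathbin{\Box\!\!\rightarrow}x)\vee((x\vee y)\mathbin{\Box\!\!\rightarrow}y)\vee(((x\vee y)\mathbin{\Box\!\!\rightarrow}z)\leftrightarrow((x\mathbin{\Box\!\!\rightarrow}z)\wedge(y\mathbin{\Box\!\!\rightarrow}z)))=1$; $x\mathbin{\Box\!\!\rightarrow}(y\wedge z)=(x\mathbin{\Box\!\!\rightarrow}y)\wedge(x\mathbin{\Box\!\!\rightarrow}z)$. $\Box x:=\neg x\mathbin{\Box\!\!\rightarrow}x$ is the term-defined unary modal operator, and the modal reduct is the Boolean algebra with this operator. A congruence filter is the 1-block $\{a:(a,1)\in\theta\}$ of a congruence $\theta$. In $\mathsf V$-algebras, the congruence filters are exactly the nonempty lattice filters closed under $\Box$ (open filters). -}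

module Defs where

open import Level using (Level; _⊔_; suc)
open import Algebra.Core using (Op₁; Op₂)
open import Algebra.Lattice.Bundles using (BooleanAlgebra)
open import Relation.Binary.Core using (Rel; _Preserves₂_⟶_⟶_; _⇒_)
open import Relation.Binary.Structures using (IsEquivalence)
open import Data.Product using (Σ; _×_)
open import Function.Bundles using (_⇔_)

record VAlgebra (c ℓ : Level) : Set (suc (c ⊔ ℓ)) where
  field
    boolAlg : BooleanAlgebra c ℓ
  open BooleanAlgebra boolAlg public
  infixr 5 _⇒ᵇ_
  infix 5 _⇔ᵇ_
  infix 4 _≤ᵇ_
  _⇒ᵇ_ : Op₂ Carrier
  x ⇒ᵇ y = (¬ x) ∨ y
  _⇔ᵇ_ : Op₂ Carrier
  x ⇔ᵇ y = (x ⇒ᵇ y) ∧ (y ⇒ᵇ x)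
  _≤ᵇ_ : Rel Carrier ℓ
  x ≤ᵇ y = (x ∧ y) ≈ x
  field
    _□→_ : Op₂ Carrier
    □→-cong : _□→_ Preserves₂ _≈_ ⟶ _≈_ ⟶ _≈_
    ax1 : ∀ x → (x □→ x) ≈ ⊤
    ax2 : ∀ x y z → ((x □→ y) ∧ (y □→ x)) ≤ᵇ ((x □→ z) ⇔ᵇ (y □→ z))
    ax3 : ∀ x y z →
      (((x ∨ y) □→ x) ∨ ((x ∨ y) □→ y)
        ∨ (((x ∨ y) □→ z) ⇔ᵇ ((x □→ z) ∧ (y □→ z)))) ≈ ⊤
    ax4 : ∀ x y z → (x □→ (y ∧ z)) ≈ ((x □→ y) ∧ (x □→ z))

  □ : Op₁ Carrier
  □ x = (¬ x) □→ x

module _ {c ℓ : Level} (A : VAlgebra c ℓ) where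
  open VAlgebra A

  -- Common part of a congruence: an equivalence relation containing the
  -- setoid equality and compatible with the Boolean operations ∧, ∨, ¬
  -- (→ is term-defined from these; 0, 1 are constants).
  record IsBoolCongruence {r : Level} (θ : Rel Carrier r) : Set (c ⊔ ℓ ⊔ r) where
    field
      isEquivalence : IsEquivalence θ
      ≈⊆θ : _≈_ ⇒ θ
      ∧-compat : ∀ {x y u v} → θ x y → θ u v → θ (x ∧ u) (y ∧ v)
      ∨-compat : ∀ {x y u v} → θ x y → θ u v → θ (x ∨ u) (y ∨ v)
      ¬-compat : ∀ {x y} → θ x y → θ (¬ x) (¬ y)

  record IsVCongruence {r : Level} (θ : Rel Carrier r) : Set (c ⊔ ℓ ⊔ r) where
    field
      isBoolCongruence : IsBoolCongruence θ
      □→-compat : ∀ {x y u v} → θ x y → θ u v → θ (x □→ u) (y □→ v)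

  record IsModalCongruence {r : Level} (θ : Rel Carrier r) : Set (c ⊔ ℓ ⊔ r) where
    field
      isBoolCongruence : IsBoolCongruence θ
      □-compat : ∀ {x y} → θ x y → θ (□ x) (□ y)

  IsOneBlock : {r : Level} → (Carrier → Set r) → Rel Carrier r → Set (c ⊔ r)
  IsOneBlock F θ = ∀ a → (F a ⇔ θ a ⊤)

  IsVCongruenceFilter : {r : Level} → (Carrier → Set r) → Set (c ⊔ ℓ ⊔ suc r)
  IsVCongruenceFilter {r} F =
    Σ (Rel Carrier r) (λ θ → IsVCongruence θ × IsOneBlock F θ)

  IsModalCongruenceFilter : {r : Level} → (Carrier → Set r) → Set (c ⊔ ℓ ⊔ suc r)
  IsModalCongruenceFilter {r} F =
    Σ (Rel Carrier r) (λ θ → IsModalCongruence θ × IsOneBlock F θ)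

{-# OPTIONS --safe #-}
-- In a V-algebra □c ≤ b □→ c for every b: splitting b into b ∧ c and b ∧ ¬c, the
-- third axiom leaves three cases, each settled by monotonicity of □→ in its
-- consequent (fourth axiom) and substitution of equivalent antecedents (second
-- axiom). Hence the 1-block of a congruence θ of the modal reduct, being an
-- upward closed set closed under □, is closed under every b □→ _. Since θ relates
-- x and y exactly when x ⇔ y lies in its 1-block, this makes θ compatible with □→
-- in both arguments: the V-algebra and its modal reduct have the same
-- congruences, not only the same congruence filters.
module Submission where

open import Defs
open import Level using (Level)
open import Function.Bundles using (_⇔_; mk⇔)
open import Data.Product using (map₁; map₂)
open import Relation.Binary.Core using (Rel)
open import Relation.Binary.Structures using (IsEquivalence)
open import Relation.Binary.Bundles using (Setoid)
open import Relation.Binary.Lattice.Bundles using (Lattice)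
import Algebra.Lattice.Properties.BooleanAlgebra as BooleanAlgebraProperties
import Relation.Binary.Lattice.Properties.JoinSemilattice as JoinSemilatticeProperties
import Relation.Binary.Reasoning.PartialOrder as ≤-Reasoning
import Relation.Binary.Reasoning.Setoid as SetoidReasoning

module VAlgebraProperties {c ℓ : Level} (A : VAlgebra c ℓ) where
  open VAlgebra A
  open BooleanAlgebraProperties boolAlg
    using (∨-∧-orderTheoreticLattice; ∧-identityˡ; ∧-identityʳ; ∧-zeroˡ; ∨-identityˡ)
  open Lattice ∨-∧-orderTheoreticLattice
    using (poset; joinSemilattice; antisym; x∧y≤x; x∧y≤y; ∧-greatest; ∨-least)
    renaming (refl to ≤-refl; reflexive to ≤-reflexive; trans to ≤-trans)
  open Lattice ∨-∧-orderTheoreticLattice public using (_≤_)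
  open JoinSemilatticeProperties joinSemilattice public using (x≤y⇒x∨y≈y)
  open ≤-Reasoning poset

  ≤ᵇ⇒≤ : ∀ {x y} → x ≤ᵇ y → x ≤ y
  ≤ᵇ⇒≤ = sym

  x≤⊤ : ∀ {x} → x ≤ ⊤
  x≤⊤ {x} = sym (∧-identityʳ x)

  ⊥≤x : ∀ {x} → ⊥ ≤ x
  ⊥≤x {x} = sym (∧-zeroˡ x)

  x∧[x⇒y]≤y : ∀ {x y} → x ∧ (x ⇒ᵇ y) ≤ y
  x∧[x⇒y]≤y {x} {y} = begin
    x ∧ (¬ x ∨ y)        ≈⟨ ∧-distribˡ-∨ x (¬ x) y ⟩
    (x ∧ ¬ x) ∨ (x ∧ y)  ≈⟨ ∨-congʳ (∧-complementʳ x) ⟩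
    ⊥ ∨ (x ∧ y)          ≈⟨ ∨-identityˡ (x ∧ y) ⟩
    x ∧ y                ≤⟨ x∧y≤y x y ⟩
    y                    ∎

  ⇒ᵇ-elim : ∀ {a x y} → a ≤ x ⇒ᵇ y → a ≤ x → a ≤ y
  ⇒ᵇ-elim a≤x⇒y a≤x = ≤-trans (∧-greatest a≤x a≤x⇒y) x∧[x⇒y]≤y

  ⇔ᵇ-elimˡ : ∀ {a x y} → a ≤ x ⇔ᵇ y → a ≤ y → a ≤ x
  ⇔ᵇ-elimˡ a≤x⇔y = ⇒ᵇ-elim (≤-trans a≤x⇔y (x∧y≤y _ _))

  ⇔ᵇ-elimʳ : ∀ {a x y} → a ≤ x ⇔ᵇ y → a ≤ x → a ≤ y
  ⇔ᵇ-elimʳ a≤x⇔y = ⇒ᵇ-elim (≤-trans a≤x⇔y (x∧y≤x _ _))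

  x∧[x⇔y]≈y∧[x⇔y] : ∀ {x y} → x ∧ (x ⇔ᵇ y) ≈ y ∧ (x ⇔ᵇ y)
  x∧[x⇔y]≈y∧[x⇔y] = antisym
    (∧-greatest (⇔ᵇ-elimʳ (x∧y≤y _ _) (x∧y≤x _ _)) (x∧y≤y _ _))
    (∧-greatest (⇔ᵇ-elimˡ (x∧y≤y _ _) (x∧y≤x _ _)) (x∧y≤y _ _))

  x≈[x∧y]∨[x∧¬y] : ∀ x y → x ≈ (x ∧ y) ∨ (x ∧ ¬ y)
  x≈[x∧y]∨[x∧¬y] x y = begin-equality
    x                    ≈⟨ ∧-identityʳ x ⟨
    x ∧ ⊤                ≈⟨ ∧-congˡ (∨-complementʳ y) ⟨
    x ∧ (y ∨ ¬ y)        ≈⟨ ∧-distribˡ-∨ x y (¬ y) ⟩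
    (x ∧ y) ∨ (x ∧ ¬ y)  ∎

  ≤-by-cases₃ : ∀ {s u v w g} → s ≤ u ∨ v ∨ w →
    s ∧ u ≤ g → s ∧ v ≤ g → s ∧ w ≤ g → s ≤ g
  ≤-by-cases₃ {s} {u} {v} {w} {g} s≤u∨v∨w case-u case-v case-w = begin
    s                              ≤⟨ ∧-greatest ≤-refl s≤u∨v∨w ⟩
    s ∧ (u ∨ v ∨ w)                ≈⟨ ∧-distribˡ-∨ s u (v ∨ w) ⟩
    (s ∧ u) ∨ (s ∧ (v ∨ w))        ≈⟨ ∨-congˡ (∧-distribˡ-∨ s v w) ⟩
    (s ∧ u) ∨ (s ∧ v) ∨ (s ∧ w)    ≤⟨ ∨-least case-u (∨-least case-v case-w) ⟩
    g                              ∎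

  □→-monoʳ : ∀ {x y z} → y ≤ z → x □→ y ≤ x □→ z
  □→-monoʳ {x} {y} {z} y≤z = trans (□→-cong refl y≤z) (ax4 x y z)

  x≤y⇒x□→y≈⊤ : ∀ {x y} → x ≤ y → x □→ y ≈ ⊤
  x≤y⇒x□→y≈⊤ {x} {y} x≤y = antisym x≤⊤ (begin
    ⊤      ≈⟨ ax1 x ⟨
    x □→ x ≤⟨ □→-monoʳ x≤y ⟩
    x □→ y ∎)

  □⊤≈⊤ : □ ⊤ ≈ ⊤
  □⊤≈⊤ = x≤y⇒x□→y≈⊤ x≤⊤

  □x≤¬x□→y : ∀ x y → □ x ≤ (¬ x) □→ y
  □x≤¬x□→y x y = begin
    □ x                              ≈⟨ ∧-identityʳ (□ x) ⟨
    □ x ∧ ⊤                          ≈⟨ ∧-congˡ (ax1 (¬ x)) ⟨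
    ((¬ x) □→ x) ∧ ((¬ x) □→ (¬ x))  ≈⟨ ax4 (¬ x) x (¬ x) ⟨
    (¬ x) □→ (x ∧ ¬ x)               ≈⟨ □→-cong refl (∧-complementʳ x) ⟩
    (¬ x) □→ ⊥                       ≤⟨ □→-monoʳ ⊥≤x ⟩
    (¬ x) □→ y                       ∎

  [y□→¬x]∧□x≤y□→z : ∀ x y z → (y □→ (¬ x)) ∧ □ x ≤ y □→ z
  [y□→¬x]∧□x≤y□→z x y z = ⇔ᵇ-elimˡ
    (≤-trans (∧-greatest (x∧y≤x _ _) (≤-trans (x∧y≤y _ _) (□x≤¬x□→y x y)))
             (≤ᵇ⇒≤ (ax2 y (¬ x) z)))
    (≤-trans (x∧y≤y _ _) (□x≤¬x□→y x z))

  □x≤y□→x : ∀ x y → □ x ≤ y □→ x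
  □x≤y□→x x y = begin
    □ x           ≤⟨ ≤-by-cases₃ cases case₁ case₂ case₃ ⟩
    (p ∨ q) □→ x  ≈⟨ □→-cong (x≈[x∧y]∨[x∧¬y] y x) refl ⟨
    y □→ x        ∎
    where
    p q : Carrier
    p = y ∧ x
    q = y ∧ ¬ x

    cases : □ x ≤ ((p ∨ q) □→ p) ∨ ((p ∨ q) □→ q)
                    ∨ (((p ∨ q) □→ x) ⇔ᵇ ((p □→ x) ∧ (q □→ x)))
    cases = ≤-trans x≤⊤ (≤-reflexive (sym (ax3 p q x)))

    case₁ : □ x ∧ ((p ∨ q) □→ p) ≤ (p ∨ q) □→ x
    case₁ = ≤-trans (x∧y≤y _ _) (□→-monoʳ (x∧y≤y _ _))

    case₂ : □ x ∧ ((p ∨ q) □→ q) ≤ (p ∨ q) □→ x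
    case₂ = ≤-trans (∧-greatest (≤-trans (x∧y≤y _ _) (□→-monoʳ (x∧y≤y _ _))) (x∧y≤x _ _))
                    ([y□→¬x]∧□x≤y□→z x (p ∨ q) x)

    □x≤q□→x : □ x ≤ q □→ x
    □x≤q□→x = begin
      □ x                 ≈⟨ ∧-identityˡ (□ x) ⟨
      ⊤ ∧ □ x             ≈⟨ ∧-congʳ (x≤y⇒x□→y≈⊤ (x∧y≤y _ _)) ⟨
      (q □→ (¬ x)) ∧ □ x  ≤⟨ [y□→¬x]∧□x≤y□→z x q x ⟩
      q □→ x              ∎

    case₃ : □ x ∧ (((p ∨ q) □→ x) ⇔ᵇ ((p □→ x) ∧ (q □→ x))) ≤ (p ∨ q) □→ x
    case₃ = ⇔ᵇ-elimˡ (x∧y≤y _ _) (≤-trans (x∧y≤x _ _)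
      (∧-greatest (≤-trans x≤⊤ (≤-reflexive (sym (x≤y⇒x□→y≈⊤ (x∧y≤y _ _))))) □x≤q□→x))

  x□→[x⇒y]≤x□→y : ∀ x y → x □→ (x ⇒ᵇ y) ≤ x □→ y
  x□→[x⇒y]≤x□→y x y = begin
    x □→ (x ⇒ᵇ y)                ≈⟨ ∧-identityˡ _ ⟨
    ⊤ ∧ (x □→ (x ⇒ᵇ y))          ≈⟨ ∧-congʳ (ax1 x) ⟨
    (x □→ x) ∧ (x □→ (x ⇒ᵇ y))   ≈⟨ ax4 x x (x ⇒ᵇ y) ⟨
    x □→ (x ∧ (x ⇒ᵇ y))          ≤⟨ □→-monoʳ x∧[x⇒y]≤y ⟩
    x □→ y                       ∎

module BooleanCongruenceProperties
  {c ℓ r : Level} (A : VAlgebra c ℓ)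
  {θ : Rel (VAlgebra.Carrier A) r} (isBoolCongruence : IsBoolCongruence A θ) where
  open VAlgebra A
  open VAlgebraProperties A
  open BooleanAlgebraProperties boolAlg using (∧-identityʳ; ∨-zeroˡ)
  open IsBoolCongruence isBoolCongruence renaming (isEquivalence to θ-isEquivalence)
  open IsEquivalence θ-isEquivalence using ()
    renaming (refl to θ-refl; sym to θ-sym; trans to θ-trans)

  θ-setoid : Setoid c r
  θ-setoid = record { isEquivalence = θ-isEquivalence }

  open SetoidReasoning θ-setoid

  θ[x,⊤]-upward : ∀ {x y} → x ≤ y → θ x ⊤ → θ y ⊤
  θ[x,⊤]-upward {x} {y} x≤y θx⊤ = begin
    y      ≈⟨ ≈⊆θ (x≤y⇒x∨y≈y x≤y) ⟨
    x ∨ y  ≈⟨ ∨-compat θx⊤ θ-refl ⟩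
    ⊤ ∨ y  ≈⟨ ≈⊆θ (∨-zeroˡ y) ⟩
    ⊤      ∎

  θ[x∧y,⊤] : ∀ {x y} → θ x ⊤ → θ y ⊤ → θ (x ∧ y) ⊤
  θ[x∧y,⊤] θx⊤ θy⊤ = θ-trans (∧-compat θx⊤ θy⊤) (≈⊆θ (∧-identityʳ ⊤))

  θ-by-∧ : ∀ {x y d} → θ d ⊤ → x ∧ d ≈ y ∧ d → θ x y
  θ-by-∧ {x} {y} {d} θd⊤ x∧d≈y∧d = begin
    x      ≈⟨ ≈⊆θ (∧-identityʳ x) ⟨
    x ∧ ⊤  ≈⟨ ∧-compat θ-refl θd⊤ ⟨
    x ∧ d  ≈⟨ ≈⊆θ x∧d≈y∧d ⟩
    y ∧ d  ≈⟨ ∧-compat θ-refl θd⊤ ⟩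
    y ∧ ⊤  ≈⟨ ≈⊆θ (∧-identityʳ y) ⟩
    y      ∎

  θ⇒θ[⇒,⊤] : ∀ {x y} → θ x y → θ (x ⇒ᵇ y) ⊤
  θ⇒θ[⇒,⊤] θxy = θ-trans (∨-compat (¬-compat θxy) θ-refl) (≈⊆θ (∨-complementˡ _))

  θ⇒θ[⇔,⊤] : ∀ {x y} → θ x y → θ (x ⇔ᵇ y) ⊤
  θ⇒θ[⇔,⊤] θxy = θ[x∧y,⊤] (θ⇒θ[⇒,⊤] θxy) (θ⇒θ[⇒,⊤] (θ-sym θxy))

  θ[⇔,⊤]⇒θ : ∀ {x y} → θ (x ⇔ᵇ y) ⊤ → θ x y
  θ[⇔,⊤]⇒θ θ[x⇔y,⊤] = θ-by-∧ θ[x⇔y,⊤] x∧[x⇔y]≈y∧[x⇔y]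

module ModalCongruenceProperties
  {c ℓ r : Level} (A : VAlgebra c ℓ)
  {θ : Rel (VAlgebra.Carrier A) r} (isModalCongruence : IsModalCongruence A θ) where
  open VAlgebra A
  open VAlgebraProperties A
  open IsModalCongruence isModalCongruence
  open IsBoolCongruence isBoolCongruence renaming (isEquivalence to θ-isEquivalence)
  open IsEquivalence θ-isEquivalence using () renaming (sym to θ-sym; trans to θ-trans)
  open BooleanCongruenceProperties A isBoolCongruence

  θ[x,⊤]⇒θ[y□→x,⊤] : ∀ {x y} → θ x ⊤ → θ (y □→ x) ⊤
  θ[x,⊤]⇒θ[y□→x,⊤] {x} {y} θx⊤ =
    θ[x,⊤]-upward (□x≤y□→x x y) (θ-trans (□-compat θx⊤) (≈⊆θ □⊤≈⊤))

  □→-compatʳ : ∀ {x y z} → θ y z → θ (x □→ y) (x □→ z)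
  □→-compatʳ {x} {y} {z} θyz =
    θ-by-∧ (θ[x,⊤]⇒θ[y□→x,⊤] (θ⇒θ[⇔,⊤] θyz)) (begin
      (x □→ y) ∧ (x □→ (y ⇔ᵇ z))  ≈⟨ ax4 x y (y ⇔ᵇ z) ⟨
      x □→ (y ∧ (y ⇔ᵇ z))         ≈⟨ □→-cong refl x∧[x⇔y]≈y∧[x⇔y] ⟩
      x □→ (z ∧ (y ⇔ᵇ z))         ≈⟨ ax4 x z (y ⇔ᵇ z) ⟩
      (x □→ z) ∧ (x □→ (y ⇔ᵇ z))  ∎)
    where open SetoidReasoning setoid

  θ⇒θ[x□→y,⊤] : ∀ {x y} → θ x y → θ (x □→ y) ⊤
  θ⇒θ[x□→y,⊤] {x} {y} θxy =
    θ[x,⊤]-upward (x□→[x⇒y]≤x□→y x y) (θ[x,⊤]⇒θ[y□→x,⊤] (θ⇒θ[⇒,⊤] θxy))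

  □→-compatˡ : ∀ {x y z} → θ x y → θ (x □→ z) (y □→ z)
  □→-compatˡ {x} {y} {z} θxy = θ[⇔,⊤]⇒θ (θ[x,⊤]-upward (≤ᵇ⇒≤ (ax2 x y z))
    (θ[x∧y,⊤] (θ⇒θ[x□→y,⊤] θxy) (θ⇒θ[x□→y,⊤] (θ-sym θxy))))

  isVCongruence : IsVCongruence A θ
  isVCongruence = record
    { isBoolCongruence = isBoolCongruence
    ; □→-compat        = λ θxy θuv → θ-trans (□→-compatˡ θxy) (□→-compatʳ θuv)
    }

isVCongruence⇒isModalCongruence : ∀ {c ℓ r} (A : VAlgebra c ℓ)
  {θ : Rel (VAlgebra.Carrier A) r} → IsVCongruence A θ → IsModalCongruence A θ
isVCongruence⇒isModalCongruence A isVCongruence = record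
  { isBoolCongruence = isBoolCongruence
  ; □-compat         = λ θxy → □→-compat (¬-compat θxy) θxy
  }
  where
  open IsVCongruence isVCongruence
  open IsBoolCongruence isBoolCongruence using (¬-compat)

isModalCongruence⇒isVCongruence : ∀ {c ℓ r} (A : VAlgebra c ℓ)
  {θ : Rel (VAlgebra.Carrier A) r} → IsModalCongruence A θ → IsVCongruence A θ
isModalCongruence⇒isVCongruence A isModalCongruence =
  ModalCongruenceProperties.isVCongruence A isModalCongruence

corollary4p10 : {c ℓ r : Level} (A : VAlgebra c ℓ) (F : VAlgebra.Carrier A → Set r) →
    IsVCongruenceFilter A F ⇔ IsModalCongruenceFilter A F
corollary4p10 A _ = mk⇔
  (map₂ (map₁ (isVCongruence⇒isModalCongruence A)))
  (map₂ (map₁ (isModalCongruence⇒isVCongruence A)))
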